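{- Fix $r\ge1$ and integers $1\le a_1\le\dots\le a_r$. Suppose there are integers $B_i\ge A_i\ge3$ ($1\le i\le r$) with the following property: for every $1\le i\le r$ and every choice of integers $A_j\le m_j\le B_j$ ($j\ne i$), there exists an integer $A_i\le m_i'\le B_i$ such that the sum $F'=a_1P_{m_1}+\cdots+a_iP_{m_i'}+\cdots+a_rP_{m_r}$ is not universal and satisfies $\lfloor t(F')/a_k\rfloor+3\le B_k$ for all $1\le k\le r$. Then every sum $F=a_1P_{m_1}+\cdots+a_rP_{m_r}$ with $m_i\ge A_i$ for all $i$ and $m_j\ge B_j+1$ for some $j$ has truant $$t(F)\le t_{\max}:=\max\{t(a_1P_{m_1}+\cdots+a_rP_{m_r})<\infty : A_i\le m_i\le B_i\text{ for }1\le i\le r\}.$$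
   Context: For $m\ge3$, $P_m(x)=\frac{(m-2)x^2-(m-4)x}{2}$ ($x\in\mathbb{Z}$). A sum of generalized polygonal numbers is $F=\sum_{j=1}^ra_jP_{m_j}$, as a function of $(x_1,\dots,x_r)\in\mathbb{Z}^r$, with integers $1\le a_1\le\dots\le a_r$ and $m_j\ge3$. It represents $n$ if $n=F(x)$ for some $x$; it is universal if it represents every positive integer. The truant $t(F)$ is the smallest positive integer not represented ($t(F)=\infty$ if universal). -}

module Defs where

open import Data.Nat as ℕ using (ℕ; zero; suc; _≤_; _<_)
open import Data.Integer as ℤ using (ℤ; +_; _/ℕ_)
open import Data.Fin using (Fin; zero; suc; _≟_)
open import Data.Product using (Σ; ∃; _×_)
open import Relation.Nullary using (¬_; yes; no)
open import Relation.Binary.PropositionalEquality using (_≡_)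

-- Generalized polygonal number P_m(x) = ((m-2)x^2 - (m-4)x)/2 (exact division)
P : ℕ → ℤ → ℤ
P m x = ((((+ m) ℤ.- (+ 2)) ℤ.* x ℤ.* x) ℤ.- (((+ m) ℤ.- (+ 4)) ℤ.* x)) /ℕ 2

sumℤ : ∀ {r} → (Fin r → ℤ) → ℤ
sumℤ {zero}  f = + 0
sumℤ {suc r} f = f zero ℤ.+ sumℤ (λ i → f (suc i))

F : ∀ {r} → (Fin r → ℕ) → (Fin r → ℕ) → (Fin r → ℤ) → ℤ
F a m x = sumℤ (λ j → (+ a j) ℤ.* P (m j) (x j))

Represents : ∀ {r} → (Fin r → ℕ) → (Fin r → ℕ) → ℕ → Set
Represents a m n = ∃ λ (x : Fin _ → ℤ) → F a m x ≡ + n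

Universal : ∀ {r} → (Fin r → ℕ) → (Fin r → ℕ) → Set
Universal a m = ∀ n → 1 ≤ n → Represents a m n

IsTruant : ∀ {r} → (Fin r → ℕ) → (Fin r → ℕ) → ℕ → Set
IsTruant a m t = (1 ≤ t) × ¬ Represents a m t × (∀ k → 1 ≤ k → k < t → Represents a m k)

setAt : ∀ {r} → (Fin r → ℕ) → Fin r → ℕ → (Fin r → ℕ)
setAt m i v j with j ≟ i
... | yes _ = v
... | no  _ = m j

InBox : ∀ {r} → (Fin r → ℕ) → (Fin r → ℕ) → (Fin r → ℕ) → Set
InBox A B m = ∀ j → A j ≤ m j × m j ≤ B j

-- Clamp the orders of F to m̃ = min(m, B) and apply the hypothesis at an index j with m_j > B_j:
-- this yields F₀ in the box, with truant t₀ and t₀/a_k + 3 ≤ B_k. F₀ and F differ only at orders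
-- m_k > B_k, and in a representation of t₀ by F every P_{m_k}(x_k) ≤ t₀/a_k < m_k − 3, which
-- forces x_k ∈ {0, 1}, where P_m(x) = x for all m. So F₀ would represent t₀ too; hence F misses t₀
-- and its truant is at most t₀. Representability is decidable since |x| ≤ P_m(x) + 1 bounds
-- the search.

{-# OPTIONS --safe #-}
module Submission where

open import Defs
open import Data.Nat using (ℕ; _≤_; _<_; _+_; suc; >-nonZero)
open import Data.Nat.DivMod using (_/_)
open import Data.Fin using (Fin)
open import Data.Product using (Σ; ∃; _×_)
open import Relation.Nullary using (¬_)
open import Relation.Binary.PropositionalEquality using (_≡_)

open import Data.Nat using (zero; z≤n; s≤s; _*_; _∸_; _⊓_; _≤?_; _≟_; NonZero)
open import Data.Nat.Properties
open import Data.Nat.DivMod using (m*n/n≡m; /-monoˡ-≤)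
open import Data.Nat.Tactic.RingSolver as ℕ-Solver using ()
open import Data.Integer as ℤ using (ℤ; +_; -[1+_]; ∣_∣)
import Data.Integer.Properties as ℤP
open import Data.Integer.Tactic.RingSolver as ℤ-Solver using ()
open import Data.Fin as Fin using (zero; suc; toℕ; fromℕ<)
import Data.Fin.Properties as FinP
open import Data.Vec.Functional using (_∷_; head; tail)
open import Data.Product using (_,_; proj₁; proj₂)
open import Data.Sum using (_⊎_; inj₁; inj₂; [_,_]; map₂)
open import Function using (_∘_; _⇔_; mk⇔; Equivalence)
open import Function.Construct.Symmetry using (⇔-sym)
open import Relation.Nullary using (Dec; yes; no; contradiction)
open import Relation.Nullary.Decidable using (map; map′; _⊎-dec_)
open import Relation.Unary using (Decidable)
open import Relation.Binary.PropositionalEquality using (refl; sym; trans; cong; cong₂; subst; module ≡-Reasoning)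
open ≡-Reasoning

triangle : ℕ → ℕ
triangle zero    = 0
triangle (suc n) = suc n + triangle n

2*triangle≡n*[1+n] : ∀ n → 2 * triangle n ≡ n * suc n
2*triangle≡n*[1+n] zero    = refl
2*triangle≡n*[1+n] (suc n) = begin
  2 * (suc n + triangle n)         ≡⟨ *-distribˡ-+ 2 (suc n) (triangle n) ⟩
  2 * suc n + 2 * triangle n       ≡⟨ cong (_+_ (2 * suc n)) (2*triangle≡n*[1+n] n) ⟩
  2 * suc n + n * suc n            ≡⟨ *-distribʳ-+ (suc n) 2 n ⟨
  suc (suc n) * suc n              ≡⟨ *-comm (suc (suc n)) (suc n) ⟩
  suc n * suc (suc n)              ∎

n≤triangle : ∀ n → n ≤ triangle n
n≤triangle zero    = z≤n
n≤triangle (suc n) = m≤m+n (suc n) (triangle n)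

triangleℤ : ℤ → ℕ
triangleℤ (+ n)    = triangle n
triangleℤ -[1+ n ] = triangle n

+[2*triangleℤ]≡x*[x+1] : ∀ x → + (2 * triangleℤ x) ≡ x ℤ.* (x ℤ.+ + 1)
+[2*triangleℤ]≡x*[x+1] (+ n) = begin
  + (2 * triangle n)     ≡⟨ cong +_ (2*triangle≡n*[1+n] n) ⟩
  + (n * suc n)          ≡⟨ ℤP.pos-* n (suc n) ⟩
  + n ℤ.* (+ 1 ℤ.+ + n)  ≡⟨ flip (+ n) ⟩
  + n ℤ.* (+ n ℤ.+ + 1)  ∎
  where
  flip : ∀ X → X ℤ.* (+ 1 ℤ.+ X) ≡ X ℤ.* (X ℤ.+ + 1)
  flip = ℤ-Solver.solve-∀
+[2*triangleℤ]≡x*[x+1] -[1+ n ] = begin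
  + (2 * triangle n)     ≡⟨ cong +_ (2*triangle≡n*[1+n] n) ⟩
  + (n * suc n)          ≡⟨ ℤP.pos-* n (suc n) ⟩
  + n ℤ.* (+ 1 ℤ.+ + n)  ≡⟨ reflect (+ n) ⟩
  ℤ.- (+ 1 ℤ.+ + n) ℤ.* (ℤ.- (+ 1 ℤ.+ + n) ℤ.+ + 1) ∎
  where
  reflect : ∀ X → X ℤ.* (+ 1 ℤ.+ X) ≡ ℤ.- (+ 1 ℤ.+ X) ℤ.* (ℤ.- (+ 1 ℤ.+ X) ℤ.+ + 1)
  reflect = ℤ-Solver.solve-∀

∣x∣≤1+triangleℤ : ∀ x → ∣ x ∣ ≤ suc (triangleℤ x)
∣x∣≤1+triangleℤ (+ n)    = m≤n⇒m≤1+n (n≤triangle n)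
∣x∣≤1+triangleℤ -[1+ n ] = s≤s (n≤triangle n)

-- polygonal c is P_{c+3}, written as c·T(x−1) + T(x) so that it is visibly natural-valued.
polygonal : ℕ → ℤ → ℕ
polygonal c x = c * triangleℤ (x ℤ.- + 1) + triangleℤ x

+[2*polygonal]≡numerator : ∀ c x →
  + (2 * polygonal c x) ≡ (((+ (3 + c)) ℤ.- (+ 2)) ℤ.* x ℤ.* x) ℤ.- (((+ (3 + c)) ℤ.- (+ 4)) ℤ.* x)
+[2*polygonal]≡numerator c x = begin
  + (2 * (c * T₋ + T))                  ≡⟨ cong +_ (distrib c T₋ T) ⟩
  + (c * (2 * T₋) + 2 * T)              ≡⟨ ℤP.pos-+ (c * (2 * T₋)) (2 * T) ⟩
  + (c * (2 * T₋)) ℤ.+ + (2 * T)        ≡⟨ cong (ℤ._+ + (2 * T)) (ℤP.pos-* c (2 * T₋)) ⟩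
  + c ℤ.* + (2 * T₋) ℤ.+ + (2 * T)      ≡⟨ cong₂ (λ u v → + c ℤ.* u ℤ.+ v)
                                             (+[2*triangleℤ]≡x*[x+1] (x ℤ.- + 1)) (+[2*triangleℤ]≡x*[x+1] x) ⟩
  + c ℤ.* ((x ℤ.- + 1) ℤ.* ((x ℤ.- + 1) ℤ.+ + 1)) ℤ.+ x ℤ.* (x ℤ.+ + 1)
                                        ≡⟨ expand (+ c) x ⟩
  (((+ 3 ℤ.+ + c) ℤ.- (+ 2)) ℤ.* x ℤ.* x) ℤ.- (((+ 3 ℤ.+ + c) ℤ.- (+ 4)) ℤ.* x) ∎
  where
  T₋ T : ℕ
  T₋ = triangleℤ (x ℤ.- + 1)
  T  = triangleℤ x
  distrib : ∀ c s t → 2 * (c * s + t) ≡ c * (2 * s) + 2 * t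
  distrib = ℕ-Solver.solve-∀
  expand : ∀ C X → C ℤ.* ((X ℤ.- + 1) ℤ.* ((X ℤ.- + 1) ℤ.+ + 1)) ℤ.+ X ℤ.* (X ℤ.+ + 1)
                 ≡ (((+ 3 ℤ.+ C) ℤ.- (+ 2)) ℤ.* X ℤ.* X) ℤ.- (((+ 3 ℤ.+ C) ℤ.- (+ 4)) ℤ.* X)
  expand = ℤ-Solver.solve-∀

P≡polygonal : ∀ {m} → 3 ≤ m → ∀ x → P m x ≡ + polygonal (m ∸ 3) x
P≡polygonal {m} 3≤m x = begin
  P m x                             ≡⟨ cong (λ k → P k x) (m+[n∸m]≡n 3≤m) ⟨
  P (3 + c) x                       ≡⟨ cong (ℤ._/ℕ 2) (+[2*polygonal]≡numerator c x) ⟨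
  + (2 * polygonal c x) ℤ./ℕ 2      ≡⟨ cong (λ k → + (k / 2)) (*-comm 2 (polygonal c x)) ⟩
  + (polygonal c x * 2 / 2)         ≡⟨ cong +_ (m*n/n≡m (polygonal c x) 2) ⟩
  + polygonal c x                   ∎
  where
  c : ℕ
  c = m ∸ 3

triangleℤ≤polygonal : ∀ c x → triangleℤ x ≤ polygonal c x
triangleℤ≤polygonal c x = m≤n+m (triangleℤ x) (c * triangleℤ (x ℤ.- + 1))

m*n<m⇒n≡0 : ∀ m n → m * n < m → n ≡ 0
m*n<m⇒n≡0 m zero    _   = refl
m*n<m⇒n≡0 m (suc n) m*n<m = contradiction (m≤m*n m (suc n)) (<⇒≱ m*n<m)

polygonal-small : ∀ c c′ x → polygonal c x < c → polygonal c′ x ≡ polygonal c x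
polygonal-small c c′ x small = begin
  c′ * T₋ + triangleℤ x    ≡⟨ cong (λ t → c′ * t + triangleℤ x) T₋≡0 ⟩
  c′ * 0 + triangleℤ x     ≡⟨ cong (_+ triangleℤ x) (trans (*-zeroʳ c′) (sym (*-zeroʳ c))) ⟩
  c * 0 + triangleℤ x      ≡⟨ cong (λ t → c * t + triangleℤ x) T₋≡0 ⟨
  c * T₋ + triangleℤ x     ∎
  where
  T₋ : ℕ
  T₋ = triangleℤ (x ℤ.- + 1)
  T₋≡0 : T₋ ≡ 0
  T₋≡0 = m*n<m⇒n≡0 c T₋ (≤-<-trans (m≤m+n (c * T₋) (triangleℤ x)) small)

sumℕ : ∀ {r} → (Fin r → ℕ) → ℕ
sumℕ {zero}  f = 0
sumℕ {suc r} f = f zero + sumℕ (tail f)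

sumℤ≡+sumℕ : ∀ {r} {g : Fin r → ℤ} (f : Fin r → ℕ) → (∀ j → g j ≡ + f j) → sumℤ g ≡ + sumℕ f
sumℤ≡+sumℕ {zero}  f g≡f = refl
sumℤ≡+sumℕ {suc r} {g} f g≡f = begin
  g zero ℤ.+ sumℤ (tail g)     ≡⟨ cong₂ ℤ._+_ (g≡f zero) (sumℤ≡+sumℕ (tail f) (g≡f ∘ suc)) ⟩
  + f zero ℤ.+ + sumℕ (tail f) ≡⟨ ℤP.pos-+ (f zero) (sumℕ (tail f)) ⟨
  + sumℕ f                     ∎

sumℕ-agree : ∀ {r} (f g : Fin r → ℕ) {t} → sumℕ f ≤ t → (∀ k → f k ≤ t → g k ≡ f k) → sumℕ g ≡ sumℕ f
sumℕ-agree {zero}  f g _   _     = refl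
sumℕ-agree {suc r} f g Σf≤t agree = cong₂ _+_
  (agree zero (≤-trans (m≤m+n (f zero) _) Σf≤t))
  (sumℕ-agree (tail f) (tail g) (≤-trans (m≤n+m _ (f zero)) Σf≤t) (agree ∘ suc))

Fℕ : ∀ {r} → (Fin r → ℕ) → (Fin r → ℕ) → (Fin r → ℤ) → ℕ
Fℕ a m x = sumℕ (λ j → a j * polygonal (m j ∸ 3) (x j))

F≡+Fℕ : ∀ {r} (a m : Fin r → ℕ) → (∀ j → 3 ≤ m j) → ∀ x → F a m x ≡ + Fℕ a m x
F≡+Fℕ a m 3≤m x = sumℤ≡+sumℕ _ λ j →
  trans (cong (ℤ._*_ (+ a j)) (P≡polygonal (3≤m j) (x j))) (sym (ℤP.pos-* (a j) _))

Represents⇔Fℕ : ∀ {r} (a m : Fin r → ℕ) → (∀ j → 3 ≤ m j) → ∀ n →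
                Represents a m n ⇔ ∃ λ x → Fℕ a m x ≡ n
Represents⇔Fℕ a m 3≤m n = mk⇔
  (λ (x , Fx≡n) → x , ℤP.+-injective (trans (sym (F≡+Fℕ a m 3≤m x)) Fx≡n))
  (λ (x , Fx≡n) → x , trans (F≡+Fℕ a m 3≤m x) (cong +_ Fx≡n))

∃ℤ-bounded? : ∀ {p} {Q : ℤ → Set p} → Decidable Q → ∀ n → (∀ x → Q x → ∣ x ∣ ≤ n) → Dec (∃ Q)
∃ℤ-bounded? {Q = Q} Q? n bounded =
  map (mk⇔ to from) (FinP.any? λ i → Q? (+ toℕ i) ⊎-dec Q? -[1+ toℕ i ])
  where
  to : ∃ (λ (i : Fin (suc n)) → Q (+ toℕ i) ⊎ Q -[1+ toℕ i ]) → ∃ Q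
  to (i , inj₁ q) = _ , q
  to (i , inj₂ q) = _ , q
  from : ∃ Q → ∃ (λ (i : Fin (suc n)) → Q (+ toℕ i) ⊎ Q -[1+ toℕ i ])
  from (+ k , q) = fromℕ< k<1+n , inj₁ (subst (λ j → Q (+ j)) (sym (FinP.toℕ-fromℕ< k<1+n)) q)
    where k<1+n = s≤s (bounded (+ k) q)
  from (-[1+ k ] , q) = fromℕ< k<1+n , inj₂ (subst (λ j → Q -[1+ j ]) (sym (FinP.toℕ-fromℕ< k<1+n)) q)
    where k<1+n = m≤n⇒m≤1+n (bounded -[1+ k ] q)

sumℕ-representable? : ∀ {r} (g : Fin r → ℤ → ℕ) → (∀ k x → ∣ x ∣ ≤ suc (g k x)) →
                      ∀ n → Dec (∃ λ (x : Fin r → ℤ) → sumℕ (λ k → g k (x k)) ≡ n)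
sumℕ-representable? {zero}  g _        n = map′ (λ 0≡n → (λ ()) , 0≡n) proj₂ (0 ≟ n)
sumℕ-representable? {suc r} g coercive n = map′ join split (∃ℤ-bounded? rest? (suc n) bound)
  where
  Rest : ℤ → Set
  Rest x₀ = ∃ λ y → g zero x₀ + sumℕ (λ k → g (suc k) (y k)) ≡ n
  rest? : Decidable Rest
  rest? x₀ with g zero x₀ ≤? n
  ... | no  g₀≰n = no λ (y , eq) → g₀≰n (subst (g zero x₀ ≤_) eq (m≤m+n _ _))
  ... | yes g₀≤n = map′
    (λ (y , eq) → y , trans (cong (_+_ (g zero x₀)) eq) (m+[n∸m]≡n g₀≤n))
    (λ (y , eq) → y , trans (sym (m+n∸m≡n (g zero x₀) _)) (cong (_∸ g zero x₀) eq))
    (sumℕ-representable? (tail g) (coercive ∘ suc) (n ∸ g zero x₀))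
  bound : ∀ x₀ → Rest x₀ → ∣ x₀ ∣ ≤ suc n
  bound x₀ (y , eq) = ≤-trans (coercive zero x₀) (s≤s (subst (g zero x₀ ≤_) eq (m≤m+n _ _)))
  join : ∃ Rest → ∃ λ x → sumℕ (λ k → g k (x k)) ≡ n
  join (x₀ , y , eq) = x₀ ∷ y , eq
  split : (∃ λ x → sumℕ (λ k → g k (x k)) ≡ n) → ∃ Rest
  split (x , eq) = head x , tail x , eq

represents? : ∀ {r} (a m : Fin r → ℕ) → (∀ j → 1 ≤ a j) → (∀ j → 3 ≤ m j) → ∀ n → Dec (Represents a m n)
represents? a m 1≤a 3≤m n = map (⇔-sym (Represents⇔Fℕ a m 3≤m n))
  (sumℕ-representable? (λ j y → a j * polygonal (m j ∸ 3) y) coercive n)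
  where
  coercive : ∀ j y → ∣ y ∣ ≤ suc (a j * polygonal (m j ∸ 3) y)
  coercive j y = ≤-trans (∣x∣≤1+triangleℤ y) (s≤s (≤-trans (triangleℤ≤polygonal (m j ∸ 3) y)
                   (m≤n*m _ (a j) {{>-nonZero (1≤a j)}})))

m*n≤o⇒n≤o/m : ∀ m n o .{{_ : NonZero m}} → m * n ≤ o → n ≤ o / m
m*n≤o⇒n≤o/m m n o m*n≤o =
  subst (_≤ o / m) (m*n/n≡m n m) (/-monoˡ-≤ m (subst (_≤ o) (*-comm m n) m*n≤o))

represents-transfer : ∀ {r} (a : Fin r → ℕ) (1≤a : ∀ k → 1 ≤ a k) {m m′ : Fin r → ℕ} {t} →
  (∀ k → 3 ≤ m k) → (∀ k → 3 ≤ m′ k) →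
  (∀ k → m′ k ≡ m k ⊎ _/_ t (a k) {{>-nonZero (1≤a k)}} + 3 < m k) →
  Represents a m t → Represents a m′ t
represents-transfer a 1≤a {m} {m′} {t} 3≤m 3≤m′ agree rep
  with Equivalence.to (Represents⇔Fℕ a m 3≤m t) rep
... | x , Fx≡t = Equivalence.from (Represents⇔Fℕ a m′ 3≤m′ t)
  (x , trans (sumℕ-agree _ _ (≤-reflexive Fx≡t) term-agree) Fx≡t)
  where
  term : (Fin _ → ℕ) → Fin _ → ℕ
  term o k = a k * polygonal (o k ∸ 3) (x k)
  term-agree : ∀ k → term m k ≤ t → term m′ k ≡ term m k
  term-agree k term≤t with agree k
  ... | inj₁ m′≡m = cong (λ o → a k * polygonal (o ∸ 3) (x k)) m′≡m
  ... | inj₂ large = cong (_*_ (a k)) (polygonal-small (m k ∸ 3) (m′ k ∸ 3) (x k)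
        (m+n≤o⇒m≤o∸n (suc p) (≤-<-trans (+-monoˡ-≤ 3 p≤t/a) large)))
    where
    instance
      a≢0 : NonZero (a k)
      a≢0 = >-nonZero (1≤a k)
    p : ℕ
    p = polygonal (m k ∸ 3) (x k)
    p≤t/a : p ≤ t / a k
    p≤t/a = m*n≤o⇒n≤o/m (a k) p t term≤t

least-failure : ∀ {p} {R : ℕ → Set p} → Decidable R → ∀ b →
                (∀ k → k < b → R k) ⊎ ∃ λ s → s < b × ¬ R s × (∀ k → k < s → R k)
least-failure R? zero = inj₁ λ _ ()
least-failure R? (suc b) with least-failure R? b
... | inj₂ (s , s<b , ¬Rs , below) = inj₂ (s , m<n⇒m<1+n s<b , ¬Rs , below)
... | inj₁ below with R? b
...   | no  ¬Rb = inj₂ (b , n<1+n b , ¬Rb , below)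
...   | yes Rb  = inj₁ λ k k<1+b → [ below k , (λ { refl → Rb }) ] (m<1+n⇒m<n∨m≡n k<1+b)

truant-≤ : ∀ {r} (a m : Fin r → ℕ) → (∀ j → 1 ≤ a j) → (∀ j → 3 ≤ m j) →
           ∀ {t} → 1 ≤ t → ¬ Represents a m t → ∃ λ s → IsTruant a m s × s ≤ t
truant-≤ a m 1≤a 3≤m {suc t} _ ¬rep with least-failure (represents? a m 1≤a 3≤m ∘ suc) (suc t)
... | inj₁ all = contradiction (all t (n<1+n t)) ¬rep
... | inj₂ (s , s<1+t , ¬rep-s , below) = suc s , (s≤s z≤n , ¬rep-s , represented) , s<1+t
  where
  represented : ∀ k → 1 ≤ k → k < suc s → Represents a m k
  represented (suc k) _ (s≤s k<s) = below k k<s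

truant-transfer : ∀ {r} (a : Fin r → ℕ) (1≤a : ∀ k → 1 ≤ a k) {m m′ : Fin r → ℕ} {t′} →
  (∀ k → 3 ≤ m k) → (∀ k → 3 ≤ m′ k) →
  (∀ k → m′ k ≡ m k ⊎ _/_ t′ (a k) {{>-nonZero (1≤a k)}} + 3 < m k) →
  IsTruant a m′ t′ → ∃ λ t → IsTruant a m t × t ≤ t′
truant-transfer a 1≤a {m} 3≤m 3≤m′ agree (1≤t′ , ¬rep′ , _) =
  truant-≤ a m 1≤a 3≤m 1≤t′ (¬rep′ ∘ represents-transfer a 1≤a 3≤m 3≤m′ agree)

clamp : ∀ {r} → (Fin r → ℕ) → (Fin r → ℕ) → Fin r → ℕ
clamp B m k = m k ⊓ B k

clamp-inBox : ∀ {r} {A B m : Fin r → ℕ} → (∀ k → A k ≤ m k) → (∀ k → A k ≤ B k) → InBox A B (clamp B m)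
clamp-inBox {B = B} {m = m} A≤m A≤B k = ⊓-glb (A≤m k) (A≤B k) , m⊓n≤n (m k) (B k)

setAt-inBox : ∀ {r} {A B m : Fin r → ℕ} {i v} → InBox A B m → A i ≤ v → v ≤ B i → InBox A B (setAt m i v)
setAt-inBox {i = i} m∈box A≤v v≤B k with k Fin.≟ i
... | yes refl = A≤v , v≤B
... | no  _    = m∈box k

setAt-clamp-agree : ∀ {r} {B m : Fin r → ℕ} {j} → B j < m j →
                    ∀ v k → setAt (clamp B m) j v k ≡ m k ⊎ B k < m k
setAt-clamp-agree {B = B} {m} {j} Bj<mj v k with k Fin.≟ j | m k ≤? B k
... | yes refl | yes mj≤Bj = contradiction mj≤Bj (<⇒≱ Bj<mj)
... | no  _    | yes mk≤Bk = inj₁ (m≤n⇒m⊓n≡m mk≤Bk)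
... | _        | no  mk≰Bk = inj₂ (≰⇒> mk≰Bk)

lemma2p3 : (r : ℕ) → 1 ≤ r →
    (a : Fin r → ℕ) → (ha : ∀ i → 1 ≤ a i) → (∀ i j → i Data.Fin.≤ j → a i ≤ a j) →
    (A B : Fin r → ℕ) → (∀ i → 3 ≤ A i) → (∀ i → A i ≤ B i) →
    (∀ (i : Fin r) (m : Fin r → ℕ) → (∀ j → ¬ j ≡ i → A j ≤ m j × m j ≤ B j) →
      ∃ λ (mi' : ℕ) → A i ≤ mi' × mi' ≤ B i ×
        ¬ Universal a (setAt m i mi') ×
        ∃ λ (t : ℕ) → IsTruant a (setAt m i mi') t ×
          (∀ k → (_/_ t (a k) {{>-nonZero (ha k)}}) + 3 ≤ B k)) →
    (m : Fin r → ℕ) → (∀ i → A i ≤ m i) → (∃ λ j → suc (B j) ≤ m j) →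
    ∃ λ (t : ℕ) → IsTruant a m t ×
      ∃ λ (m₀ : Fin r → ℕ) → InBox A B m₀ ×
        ∃ λ (t₀ : ℕ) → IsTruant a m₀ t₀ × t ≤ t₀
lemma2p3 _ _ a 1≤a _ A B 3≤A A≤B replace m A≤m (j , Bj<mj)
  with replace j (clamp B m) (λ k _ → clamp-inBox A≤m A≤B k)
... | m′ , A≤m′ , m′≤B , _ , t₀ , truant₀ , small =
  let (t , truant , t≤t₀) = truant-transfer a 1≤a 3≤m 3≤m₀ agree truant₀
  in t , truant , m₀ , m₀∈box , t₀ , truant₀ , t≤t₀
  where
  m₀ : Fin _ → ℕ
  m₀ = setAt (clamp B m) j m′
  m₀∈box : InBox A B m₀
  m₀∈box = setAt-inBox (clamp-inBox A≤m A≤B) A≤m′ m′≤B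
  3≤m : ∀ k → 3 ≤ m k
  3≤m k = ≤-trans (3≤A k) (A≤m k)
  3≤m₀ : ∀ k → 3 ≤ m₀ k
  3≤m₀ k = ≤-trans (3≤A k) (proj₁ (m₀∈box k))
  agree : ∀ k → m₀ k ≡ m k ⊎ _/_ t₀ (a k) {{>-nonZero (1≤a k)}} + 3 < m k
  agree k = map₂ (≤-<-trans (small k)) (setAt-clamp-agree Bj<mj m′ k)
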